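{- For every $n\ge1$, the AND, OR and XOR functions on $n$ variables, and their negations, each have goal value $\Gamma$ equal to $n$.
   Context: A partial assignment is $b\in\{0,1,*\}^n$; $a\succeq b$ means $a_i=b_i$ whenever $b_i\ne *$. For $f:\{0,1\}^n\to\{0,1\}$, $b$ is a $0$-certificate (resp. $1$-certificate) of $f$ if $f(a)=0$ (resp. $1$) for all $a\in\{0,1\}^n$ with $a\succeq b$; a certificate is a $0$- or $1$-certificate; $b$ contains a certificate if $b\succeq c$ for some certificate $c$. For $b_i=*$, $b_{x_i\leftarrow\ell}$ is $b$ with coordinate $i$ set to $\ell\in\{0,1\}$. $g:\{0,1,*\}^n\to\mathbb{Z}_{\ge0}$ is monotone if $g(b_{x_i\leftarrow\ell})\ge g(b)$ whenever $b_i=*$, and submodular if $g(b_{x_i\leftarrow\ell})-g(b)\ge g(b'_{x_i\leftarrow\ell})-g(b')$ whenever $b'\succeq b$, $b_i=b'_i=*$. A goal function for $f$ is a monotone submodular $g$ with an integer $Q\ge0$ (its goal value) such that $g(b)=Q$ for all $b\in\{0,1\}^n$ and $g(b)=Q$ iff $b$ contains a certificate of $f$. $\Gamma(f)$ is the minimum goal value of a goal function for $f$. -}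

module Defs where

open import Data.Nat using (ℕ; _≤_)
open import Data.Integer as ℤ using (ℤ; +_; _-_)
open import Data.Bool using (Bool; true; false; _∧_; _∨_; _xor_; not)
open import Data.Fin using (Fin)
open import Data.Vec using (Vec; lookup; map; foldr; _[_]≔_)
open import Data.Product using (Σ; _×_; ∃)
open import Relation.Binary.PropositionalEquality using (_≡_; _≢_)
open import Relation.Nullary using (¬_)
open import Function.Bundles using (_⇔_)

data Tri : Set where
  b0 b1 ⋆ : Tri

lit : Bool → Tri
lit false = b0
lit true  = b1

PA : ℕ → Set
PA n = Vec Tri n

total : ∀ {n} → Vec Bool n → PA n
total = map lit

_⪰_ : ∀ {n} → PA n → PA n → Set
_⪰_ {n} a b = (i : Fin n) → lookup b i ≢ ⋆ → lookup a i ≡ lookup b i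

set : ∀ {n} → PA n → Fin n → Bool → PA n
set b i ℓ = b [ i ]≔ lit ℓ

BoolFn : ℕ → Set
BoolFn n = Vec Bool n → Bool

-- b is a v-certificate of f (v = false : 0-certificate, v = true : 1-certificate)
IsCertOf : ∀ {n} → BoolFn n → Bool → PA n → Set
IsCertOf {n} f v b = (a : Vec Bool n) → total a ⪰ b → f a ≡ v

IsCert : ∀ {n} → BoolFn n → PA n → Set
IsCert f b = ∃ λ v → IsCertOf f v b

ContainsCert : ∀ {n} → BoolFn n → PA n → Set
ContainsCert f b = ∃ λ c → (b ⪰ c) × IsCert f c

Monotone : ∀ {n} → (PA n → ℕ) → Set
Monotone {n} g = (b : PA n) (i : Fin n) (ℓ : Bool) →
  lookup b i ≡ ⋆ → g b ≤ g (set b i ℓ)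

Submodular : ∀ {n} → (PA n → ℕ) → Set
Submodular {n} g = (b b′ : PA n) (i : Fin n) (ℓ : Bool) →
  b′ ⪰ b → lookup b i ≡ ⋆ → lookup b′ i ≡ ⋆ →
  (+ g (set b′ i ℓ)) - (+ g b′) ℤ.≤ (+ g (set b i ℓ)) - (+ g b)

IsGoalFunction : ∀ {n} → BoolFn n → (PA n → ℕ) → ℕ → Set
IsGoalFunction {n} f g Q =
  Monotone g × Submodular g ×
  ((a : Vec Bool n) → g (total a) ≡ Q) ×
  ((b : PA n) → (g b ≡ Q) ⇔ ContainsCert f b)

-- Γ(f) = m : m is the minimum goal value of a goal function for f
GammaIs : ∀ {n} → BoolFn n → ℕ → Set
GammaIs {n} f m =
  (∃ λ g → IsGoalFunction f g m) ×
  ((g : PA n → ℕ) (Q : ℕ) → IsGoalFunction f g Q → m ≤ Q)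

AND OR XOR : ∀ {n} → BoolFn n
AND = foldr _ _∧_ true
OR  = foldr _ _∨_ false
XOR = foldr _ _xor_ false

NAND NOR XNOR : ∀ {n} → BoolFn n
NAND a = not (AND a)
NOR  a = not (OR a)
XNOR a = not (XOR a)

-- Lower bound: take an input a at which f is sensitive to every coordinate and fix the coordinates of a
-- one at a time, starting from the empty assignment. Each step raises a goal function g by at least 1:
-- a with coordinate i freed contains no certificate, so it lies strictly below the goal value Q, yet
-- fixing i brings it to Q; submodularity passes this gain on to every coarser assignment. Hence Q ≥ n.
-- Upper bound: for AND (dually OR) let g b be n when b fixes a variable to 0 and the number of fixed
-- variables otherwise; for XOR only total assignments contain certificates, and g counts fixed variables.
-- Negating f does not change its certificates.

module Submission where

open import Defs
open import Data.Nat using (ℕ; zero; suc; _+_; _≤_; _<_; z≤n; s≤s)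
open import Data.Nat.Properties
  using (≤-refl; ≤-reflexive; ≤-trans; +-comm; +-identityʳ; +-suc; +-mono-≤; +-monoˡ-≤; +-monoʳ-≤;
         +-cancelʳ-≤; m≤n+m; n≤1+n; m+1+n≢m; ≤∧≢⇒<; <-irrefl; module ≤-Reasoning)
import Data.Integer as ℤ
import Data.Integer.Properties as ℤ
open import Data.Integer.Tactic.RingSolver using (solve-∀)
open import Data.Bool using (Bool; true; false; _∨_; not; if_then_else_)
open import Data.Bool.Properties using (∨-zeroʳ; ∧-zeroʳ; not-involutive; not-¬)
open import Data.Fin as Fin using (Fin; zero; suc)
open import Data.Vec using (Vec; []; _∷_; lookup; map; _[_]≔_; replicate)
open import Data.Vec.Properties
  using (lookup∘update; lookup∘update′; []≔-idempotent; []≔-lookup; map-[]≔; lookup-map; lookup-replicate)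
open import Data.Product using (_×_; ∃; _,_)
open import Data.Sum using (_⊎_; inj₁; inj₂)
open import Data.Empty using (⊥-elim)
open import Relation.Binary.PropositionalEquality
open import Relation.Nullary using (¬_; yes; no)
open import Function using (_∘_)
open import Function.Bundles using (_⇔_; mk⇔; Equivalence)
open import Function.Construct.Composition using (_⇔-∘_)
open import Function.Construct.Symmetry using (⇔-sym)

private
  variable
    n : ℕ

diff≤diff⇔ : ∀ x y z w → (ℤ.+ x ℤ.- ℤ.+ y ℤ.≤ ℤ.+ z ℤ.- ℤ.+ w) ⇔ (x + w ≤ z + y)
diff≤diff⇔ x y z w = mk⇔ to from
  where
  open import Data.Integer using (+_; _-_; -_) renaming (_+_ to _⊕_)
  to : + x - + y ℤ.≤ + z - + w → x + w ≤ z + y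
  to le = ℤ.drop‿+≤+ (subst₂ ℤ._≤_ (cancel₁ (+ x) (+ y) (+ w)) (cancel₂ (+ z) (+ w) (+ y))
            (ℤ.+-monoˡ-≤ (+ y ⊕ + w) le))
    where
    cancel₁ : ∀ i j k → (i - j) ⊕ (j ⊕ k) ≡ i ⊕ k
    cancel₁ = solve-∀
    cancel₂ : ∀ i j k → (i - j) ⊕ (k ⊕ j) ≡ i ⊕ k
    cancel₂ = solve-∀
  from : x + w ≤ z + y → + x - + y ℤ.≤ + z - + w
  from le = subst₂ ℤ._≤_ (cancel₁ (+ x) (+ y) (+ w)) (cancel₂ (+ z) (+ w) (+ y))
              (ℤ.+-monoˡ-≤ (- (+ y) - (+ w)) (ℤ.+≤+ le))
    where
    cancel₁ : ∀ i j k → (i ⊕ k) ⊕ (- j - k) ≡ i - j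
    cancel₁ = solve-∀
    cancel₂ : ∀ i j k → (i ⊕ k) ⊕ (- k - j) ≡ i - j
    cancel₂ = solve-∀

true≢false : true ≢ false
true≢false ()

lit≢⋆ : ∀ ℓ → lit ℓ ≢ ⋆
lit≢⋆ false ()
lit≢⋆ true ()

lit-injective : ∀ {x y} → lit x ≡ lit y → x ≡ y
lit-injective {false} {false} _ = refl
lit-injective {true}  {true}  _ = refl

-- _⪰_ unfolds to a function type, so its arguments are never inferred: they are passed by name below.
⪰-refl : {b : PA n} → b ⪰ b
⪰-refl _ _ = refl

⪰-trans : {a b c : PA n} → a ⪰ b → b ⪰ c → a ⪰ c
⪰-trans a⪰b b⪰c i cᵢ≢⋆ = trans (a⪰b i (λ bᵢ≡⋆ → cᵢ≢⋆ (trans (sym (b⪰c i cᵢ≢⋆)) bᵢ≡⋆))) (b⪰c i cᵢ≢⋆)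

[]≔-⪰ : {a b : PA n} (i : Fin n) {t : Tri} → a ⪰ b → (lookup b i ≢ ⋆ → t ≡ lookup b i) → (a [ i ]≔ t) ⪰ b
[]≔-⪰ {a = a} i a⪰b t≡bᵢ j bⱼ≢⋆ with j Fin.≟ i
... | yes refl = trans (lookup∘update i a _) (t≡bᵢ bⱼ≢⋆)
... | no j≢i   = trans (lookup∘update′ j≢i a _) (a⪰b j bⱼ≢⋆)

⪰-[]≔ : {a b : PA n} (i : Fin n) {t : Tri} → a ⪰ b → (t ≢ ⋆ → lookup a i ≡ t) → a ⪰ (b [ i ]≔ t)
⪰-[]≔ {b = b} i a⪰b aᵢ≡t j ≢⋆ with j Fin.≟ i
... | yes refl = trans (aᵢ≡t (≢⋆ ∘ trans (lookup∘update i b _))) (sym (lookup∘update i b _))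
... | no j≢i   = trans (a⪰b j (≢⋆ ∘ trans (lookup∘update′ j≢i b _))) (sym (lookup∘update′ j≢i b _))

set-⪰ : (b : PA n) (i : Fin n) (ℓ : Bool) → lookup b i ≡ ⋆ → set b i ℓ ⪰ b
set-⪰ b i ℓ bᵢ≡⋆ = []≔-⪰ {a = b} {b} i (⪰-refl {b = b}) (λ bᵢ≢⋆ → ⊥-elim (bᵢ≢⋆ bᵢ≡⋆))

total-⪰⇒≡ : (a a′ : Vec Bool n) → total a ⪰ total a′ → a ≡ a′
total-⪰⇒≡ []      []        _  = refl
total-⪰⇒≡ (x ∷ a) (x′ ∷ a′) ⪰′ =
  cong₂ _∷_ (lit-injective (⪰′ zero (lit≢⋆ x′))) (total-⪰⇒≡ a a′ (⪰′ ∘ suc))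

total-isCert : (f : BoolFn n) (a : Vec Bool n) → IsCert f (total a)
total-isCert f a = f a , λ a′ a′⪰a → cong f (total-⪰⇒≡ a′ a a′⪰a)

Sensitive : BoolFn n → Vec Bool n → Fin n → Set
Sensitive f a i = f (a [ i ]≔ true) ≢ f (a [ i ]≔ false)

FullySensitive : BoolFn n → Vec Bool n → Set
FullySensitive f a = ∀ i → Sensitive f a i

sensitive⇒¬ContainsCert : {f : BoolFn n} {a : Vec Bool n} {b : PA n} {i : Fin n} →
  total a ⪰ b → lookup b i ≡ ⋆ → Sensitive f a i → ¬ ContainsCert f b
sensitive⇒¬ContainsCert {f = f} {a} {b} {i} a⪰b bᵢ≡⋆ sensitive (c , b⪰c , v , isCert) =
  sensitive (trans (value true) (sym (value false)))
  where
  value : ∀ x → f (a [ i ]≔ x) ≡ v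
  value x = isCert (a [ i ]≔ x) (⪰-trans {a = total (a [ i ]≔ x)} {b} {c} flipped⪰b b⪰c)
    where
    flipped⪰b : total (a [ i ]≔ x) ⪰ b
    flipped⪰b = subst (_⪰ b) (sym (map-[]≔ lit a i))
                  ([]≔-⪰ {a = total a} {b} i a⪰b (λ bᵢ≢⋆ → ⊥-elim (bᵢ≢⋆ bᵢ≡⋆)))

weight : Tri → ℕ
weight ⋆  = 0
weight b0 = 1
weight b1 = 1

assigned : PA n → ℕ
assigned []      = 0
assigned (t ∷ b) = weight t + assigned b

weight-lit : ∀ ℓ → weight (lit ℓ) ≡ 1
weight-lit false = refl
weight-lit true  = refl

weight≤1 : ∀ t → weight t ≤ 1
weight≤1 ⋆  = z≤n
weight≤1 b0 = s≤s z≤n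
weight≤1 b1 = s≤s z≤n

assigned≤n : (b : PA n) → assigned b ≤ n
assigned≤n []      = z≤n
assigned≤n (t ∷ b) = +-mono-≤ (weight≤1 t) (assigned≤n b)

assigned-set : (b : PA n) (i : Fin n) (ℓ : Bool) → lookup b i ≡ ⋆ → assigned (set b i ℓ) ≡ suc (assigned b)
assigned-set (⋆ ∷ b) zero    ℓ refl  = cong (_+ assigned b) (weight-lit ℓ)
assigned-set (t ∷ b) (suc i) ℓ bᵢ≡⋆ = trans (cong (weight t +_) (assigned-set b i ℓ bᵢ≡⋆)) (+-suc (weight t) (assigned b))

assigned-total : (a : Vec Bool n) → assigned (total a) ≡ n
assigned-total []      = refl
assigned-total (x ∷ a) = cong₂ _+_ (weight-lit x) (assigned-total a)

assigned-replicate⋆ : ∀ n → assigned (replicate n ⋆) ≡ 0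
assigned-replicate⋆ zero    = refl
assigned-replicate⋆ (suc n) = assigned-replicate⋆ n

weight-⪰ : ∀ t t′ → (t ≢ ⋆ → t′ ≡ t) → weight t ≤ weight t′
weight-⪰ ⋆  _ _    = z≤n
weight-⪰ b0 _ t′≡t rewrite t′≡t (λ ()) = ≤-refl
weight-⪰ b1 _ t′≡t rewrite t′≡t (λ ()) = ≤-refl

assigned-⪰ : {b′ b : PA n} → b′ ⪰ b → assigned b ≤ assigned b′
assigned-⪰ {b′ = []}      {[]}    _     = z≤n
assigned-⪰ {b′ = t′ ∷ b′} {t ∷ b} b′⪰b = +-mono-≤ (weight-⪰ t t′ (b′⪰b zero)) (assigned-⪰ {b′ = b′} {b} (b′⪰b ∘ suc))

⋆-or-total : (b : PA n) → (∃ λ i → lookup b i ≡ ⋆) ⊎ (∃ λ a → b ≡ total a)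
⋆-or-total []       = inj₂ ([] , refl)
⋆-or-total (⋆ ∷ b)  = inj₁ (zero , refl)
⋆-or-total (b0 ∷ b) with ⋆-or-total b
... | inj₁ (i , bᵢ≡⋆) = inj₁ (suc i , bᵢ≡⋆)
... | inj₂ (a , refl) = inj₂ (false ∷ a , refl)
⋆-or-total (b1 ∷ b) with ⋆-or-total b
... | inj₁ (i , bᵢ≡⋆) = inj₁ (suc i , bᵢ≡⋆)
... | inj₂ (a , refl) = inj₂ (true ∷ a , refl)

assigned<n : (b : PA n) (i : Fin n) → lookup b i ≡ ⋆ → assigned b < n
assigned<n {n} b i bᵢ≡⋆ = subst (_≤ n) (assigned-set b i true bᵢ≡⋆) (assigned≤n (set b i true))

assigned≡n⇒total : (b : PA n) → assigned b ≡ n → ∃ λ a → b ≡ total a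
assigned≡n⇒total b assigned≡n with ⋆-or-total b
... | inj₁ (i , bᵢ≡⋆) = ⊥-elim (<-irrefl assigned≡n (assigned<n b i bᵢ≡⋆))
... | inj₂ total-b    = total-b

module _ {f : BoolFn n} {g : PA n → ℕ} {Q : ℕ}
  (monotone : Monotone g) (submodular : Submodular g)
  (goal-at-total : (a : Vec Bool n) → g (total a) ≡ Q)
  (goal⇔cert : (b : PA n) → (g b ≡ Q) ⇔ ContainsCert f b)
  {a : Vec Bool n} (sensitive : FullySensitive f a) where

  goal-increases : (b : PA n) (i : Fin n) → total a ⪰ b → lookup b i ≡ ⋆ →
    suc (g b) ≤ g (set b i (lookup a i))
  goal-increases b i a⪰b bᵢ≡⋆ = +-cancelʳ-≤ (g b′) (suc (g b)) (g (set b i ℓ)) (begin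
      suc (g b) + g b′        ≡⟨ cong suc (+-comm (g b) (g b′)) ⟩
      suc (g b′) + g b        ≤⟨ +-monoˡ-≤ (g b) g-b′<Q ⟩
      Q + g b                 ≡⟨ cong (_+ g b) (sym g-set-b′≡Q) ⟩
      g (set b′ i ℓ) + g b    ≤⟨ diminishing ⟩
      g (set b i ℓ) + g b′    ∎)
    where
    open ≤-Reasoning
    ℓ = lookup a i
    b′ = total a [ i ]≔ ⋆
    b′ᵢ≡⋆ : lookup b′ i ≡ ⋆
    b′ᵢ≡⋆ = lookup∘update i (total a) ⋆
    b′⪰b : b′ ⪰ b
    b′⪰b = []≔-⪰ {a = total a} {b} i a⪰b (λ bᵢ≢⋆ → ⊥-elim (bᵢ≢⋆ bᵢ≡⋆))
    a⪰b′ : total a ⪰ b′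
    a⪰b′ = ⪰-[]≔ {a = total a} {total a} i (⪰-refl {b = total a}) (λ ⋆≢⋆ → ⊥-elim (⋆≢⋆ refl))
    set-b′≡a : set b′ i ℓ ≡ total a
    set-b′≡a = trans ([]≔-idempotent (total a) i)
                 (trans (cong (total a [ i ]≔_) (sym (lookup-map i lit a))) ([]≔-lookup (total a) i))
    diminishing : g (set b′ i ℓ) + g b ≤ g (set b i ℓ) + g b′
    diminishing = Equivalence.to (diff≤diff⇔ (g (set b′ i ℓ)) (g b′) (g (set b i ℓ)) (g b))
                    (submodular b b′ i ℓ b′⪰b bᵢ≡⋆ b′ᵢ≡⋆)
    g-set-b′≡Q : g (set b′ i ℓ) ≡ Q
    g-set-b′≡Q = trans (cong g set-b′≡a) (goal-at-total a)
    g-b′<Q : g b′ < Q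
    g-b′<Q = ≤∧≢⇒< (subst (g b′ ≤_) g-set-b′≡Q (monotone b′ i ℓ b′ᵢ≡⋆))
               (sensitive⇒¬ContainsCert {b = b′} a⪰b′ b′ᵢ≡⋆ (sensitive i) ∘ Equivalence.to (goal⇔cert b′))

  goal+unassigned≤Q : ∀ k (b : PA n) → total a ⪰ b → assigned b + k ≡ n → g b + k ≤ Q
  goal+unassigned≤Q zero b _ eq with assigned≡n⇒total b (trans (sym (+-identityʳ _)) eq)
  ... | a₀ , refl = ≤-reflexive (trans (+-identityʳ _) (goal-at-total a₀))
  goal+unassigned≤Q (suc k) b a⪰b eq with ⋆-or-total b
  ... | inj₂ (a₀ , refl) = ⊥-elim (m+1+n≢m n (trans (cong (_+ suc k) (sym (assigned-total a₀))) eq))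
  ... | inj₁ (i , bᵢ≡⋆) = begin
      g b + suc k        ≡⟨ +-suc (g b) k ⟩
      suc (g b) + k      ≤⟨ +-monoˡ-≤ k (goal-increases b i a⪰b bᵢ≡⋆) ⟩
      g (set b i ℓ) + k  ≤⟨ goal+unassigned≤Q k (set b i ℓ) a⪰set-b assigned-set-b ⟩
      Q                  ∎
    where
    open ≤-Reasoning
    ℓ = lookup a i
    a⪰set-b : total a ⪰ set b i ℓ
    a⪰set-b = ⪰-[]≔ {a = total a} {b} i a⪰b (λ _ → lookup-map i lit a)
    assigned-set-b : assigned (set b i ℓ) + k ≡ n
    assigned-set-b = trans (cong (_+ k) (assigned-set b i ℓ bᵢ≡⋆)) (trans (sym (+-suc (assigned b) k)) eq)

  n≤goal-value : n ≤ Q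
  n≤goal-value = ≤-trans (m≤n+m n (g (replicate n ⋆)))
    (goal+unassigned≤Q n (replicate n ⋆) (λ j ≢⋆ → ⊥-elim (≢⋆ (lookup-replicate j ⋆))) (cong (_+ n) (assigned-replicate⋆ n)))

-- The hypotheses make the assignments containing a certificate exactly those satisfying P or total.
module TriggeredGoal {f : BoolFn n} (P : PA n → Bool) (p : Bool → Bool)
  (P-⪰ : ∀ {b b′ : PA n} → b′ ⪰ b → P b ≡ true → P b′ ≡ true)
  (P-set : ∀ b i ℓ → lookup b i ≡ ⋆ → P (set b i ℓ) ≡ p ℓ ∨ P b)
  (P⇒IsCert : ∀ b → P b ≡ true → IsCert f b)
  (¬P⇒sensitive : ∀ b → P b ≡ false → ∃ λ a → total a ⪰ b × FullySensitive f a)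
  where

  goal : PA n → ℕ
  goal b = if P b then n else assigned b

  goal-⪰ : {b b′ : PA n} → b′ ⪰ b → goal b ≤ goal b′
  goal-⪰ {b} {b′} b′⪰b with P b in Pb | P b′ in Pb′
  ... | true  | true  = ≤-refl
  ... | true  | false = ⊥-elim (true≢false (trans (sym (P-⪰ b′⪰b Pb)) Pb′))
  ... | false | true  = assigned≤n b
  ... | false | false = assigned-⪰ {b′ = b′} {b} b′⪰b

  goal-set : (b : PA n) (i : Fin n) (ℓ : Bool) → lookup b i ≡ ⋆ →
             goal (set b i ℓ) ≡ (if p ℓ ∨ P b then n else suc (assigned b))
  goal-set b i ℓ bᵢ≡⋆ rewrite P-set b i ℓ bᵢ≡⋆ | assigned-set b i ℓ bᵢ≡⋆ = refl

  goal-diminishing : (b b′ : PA n) (i : Fin n) (ℓ : Bool) → b′ ⪰ b → lookup b i ≡ ⋆ → lookup b′ i ≡ ⋆ →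
    goal (set b′ i ℓ) + goal b ≤ goal (set b i ℓ) + goal b′
  goal-diminishing b b′ i ℓ b′⪰b bᵢ≡⋆ b′ᵢ≡⋆ rewrite goal-set b i ℓ bᵢ≡⋆ | goal-set b′ i ℓ b′ᵢ≡⋆
    with p ℓ
  ... | true = +-monoʳ-≤ n (goal-⪰ {b} {b′} b′⪰b)
  ... | false with P b in Pb | P b′ in Pb′
  ...   | true  | true  = ≤-refl
  ...   | true  | false = ⊥-elim (true≢false (trans (sym (P-⪰ b′⪰b Pb)) Pb′))
  ...   | false | true  = ≤-trans (≤-reflexive (+-comm n (assigned b))) (n≤1+n (assigned b + n))
  ...   | false | false = s≤s (≤-reflexive (+-comm (assigned b′) (assigned b)))

  goal⇔ContainsCert : (b : PA n) → (goal b ≡ n) ⇔ ContainsCert f b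
  goal⇔ContainsCert b = mk⇔ to from
    where
    to : goal b ≡ n → ContainsCert f b
    to goal≡n with P b in Pb
    ... | true  = b , ⪰-refl {b = b} , P⇒IsCert b Pb
    ... | false with assigned≡n⇒total b goal≡n
    ...   | a , refl = total a , ⪰-refl {b = total a} , total-isCert f a
    from : ContainsCert f b → goal b ≡ n
    from cert with P b in Pb
    ... | true = refl
    ... | false with ⋆-or-total b
    ...   | inj₂ (a , refl) = assigned-total a
    ...   | inj₁ (i , bᵢ≡⋆) with ¬P⇒sensitive b Pb
    ...     | a , a⪰b , sensitive = ⊥-elim (sensitive⇒¬ContainsCert {b = b} a⪰b bᵢ≡⋆ (sensitive i) cert)

  goal-isGoalFunction : IsGoalFunction f goal n
  goal-isGoalFunction = monotone , submodular , goal-total , goal⇔ContainsCert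
    where
    monotone : Monotone goal
    monotone b i ℓ bᵢ≡⋆ = goal-⪰ {b} {set b i ℓ} (set-⪰ b i ℓ bᵢ≡⋆)
    submodular : Submodular goal
    submodular b b′ i ℓ b′⪰b bᵢ≡⋆ b′ᵢ≡⋆ =
      Equivalence.from (diff≤diff⇔ (goal (set b′ i ℓ)) (goal b′) (goal (set b i ℓ)) (goal b))
        (goal-diminishing b b′ i ℓ b′⪰b bᵢ≡⋆ b′ᵢ≡⋆)
    goal-total : (a : Vec Bool n) → goal (total a) ≡ n
    goal-total a with P (total a)
    ... | true  = refl
    ... | false = assigned-total a

  Γ≡n : P (replicate n ⋆) ≡ false → GammaIs f n
  Γ≡n P⋆≡false with ¬P⇒sensitive (replicate n ⋆) P⋆≡false
  ... | _ , _ , sensitive = (goal , goal-isGoalFunction) , λ _ _ (m , s , t , c) → n≤goal-value m s t c sensitive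

isLit : Bool → Tri → Bool
isLit d b0 = not d
isLit d b1 = d
isLit d ⋆  = false

hasLit : Bool → PA n → Bool
hasLit d []      = false
hasLit d (t ∷ b) = isLit d t ∨ hasLit d b

isLit-lit : ∀ d → isLit d (lit d) ≡ true
isLit-lit false = refl
isLit-lit true  = refl

isLit⇒≡lit : ∀ d t → isLit d t ≡ true → t ≡ lit d
isLit⇒≡lit false b0 _ = refl
isLit⇒≡lit true  b1 _ = refl

≢lit⇒≡lit-not : ∀ d t → t ≢ ⋆ → t ≢ lit d → t ≡ lit (not d)
≢lit⇒≡lit-not _     ⋆  t≢⋆ _ = ⊥-elim (t≢⋆ refl)
≢lit⇒≡lit-not true  b0 _   _ = refl
≢lit⇒≡lit-not false b1 _   _ = refl
≢lit⇒≡lit-not false b0 _   t≢lit = ⊥-elim (t≢lit refl)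
≢lit⇒≡lit-not true  b1 _   t≢lit = ⊥-elim (t≢lit refl)

hasLit⇒lookup : ∀ d (b : PA n) → hasLit d b ≡ true → ∃ λ i → lookup b i ≡ lit d
hasLit⇒lookup d (t ∷ b) has with isLit d t in isLit-t
... | true  = zero , isLit⇒≡lit d t isLit-t
... | false with hasLit⇒lookup d b has
...   | i , bᵢ≡d = suc i , bᵢ≡d

lookup⇒hasLit : ∀ d (b : PA n) i → lookup b i ≡ lit d → hasLit d b ≡ true
lookup⇒hasLit d (t ∷ b) zero    refl rewrite isLit-lit d = refl
lookup⇒hasLit d (t ∷ b) (suc i) bᵢ≡d rewrite lookup⇒hasLit d b i bᵢ≡d = ∨-zeroʳ (isLit d t)

hasLit-⪰ : ∀ d {b b′ : PA n} → b′ ⪰ b → hasLit d b ≡ true → hasLit d b′ ≡ true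
hasLit-⪰ d {b} {b′} b′⪰b has with hasLit⇒lookup d b has
... | i , bᵢ≡d = lookup⇒hasLit d b′ i (trans (b′⪰b i (lit≢⋆ d ∘ trans (sym bᵢ≡d))) bᵢ≡d)

hasLit-set : ∀ d (b : PA n) i ℓ → lookup b i ≡ ⋆ → hasLit d (set b i ℓ) ≡ isLit d (lit ℓ) ∨ hasLit d b
hasLit-set d (⋆ ∷ b) zero    ℓ refl = refl
hasLit-set d (t ∷ b) (suc i) ℓ bᵢ≡⋆ rewrite hasLit-set d b i ℓ bᵢ≡⋆ with isLit d t
... | true  = sym (∨-zeroʳ _)
... | false = refl

hasLit-replicate⋆ : ∀ d n → hasLit d (replicate n ⋆) ≡ false
hasLit-replicate⋆ d zero    = refl
hasLit-replicate⋆ d (suc n) = hasLit-replicate⋆ d n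

¬hasLit⇒⪰ : ∀ d (b : PA n) → hasLit d b ≡ false → total (replicate n (not d)) ⪰ b
¬hasLit⇒⪰ {n} d b ¬has j bⱼ≢⋆ = begin
  lookup (total (replicate n (not d))) j  ≡⟨ lookup-map j lit (replicate n (not d)) ⟩
  lit (lookup (replicate n (not d)) j)    ≡⟨ cong lit (lookup-replicate j (not d)) ⟩
  lit (not d)                             ≡⟨ sym (≢lit⇒≡lit-not d (lookup b j) bⱼ≢⋆ bⱼ≢d) ⟩
  lookup b j                              ∎
  where
  open ≡-Reasoning
  bⱼ≢d : lookup b j ≢ lit d
  bⱼ≢d bⱼ≡d = true≢false (trans (sym (lookup⇒hasLit d b j bⱼ≡d)) ¬has)

record AbsorbingValue {n} (f : BoolFn n) (d : Bool) : Set where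
  field
    absorbs   : ∀ a i → lookup a i ≡ d → f a ≡ d
    otherwise : f (replicate n (not d)) ≡ not d

values⇒sensitive : {f : BoolFn n} {a : Vec Bool n} {i : Fin n} (d : Bool) →
  f (a [ i ]≔ d) ≡ d → f (a [ i ]≔ not d) ≡ not d → Sensitive f a i
values⇒sensitive true  at-d at-not-d eq = true≢false (trans (sym at-d) (trans eq at-not-d))
values⇒sensitive false at-d at-not-d eq = true≢false (trans (sym at-not-d) (trans eq at-d))

absorbing⇒sensitive : {f : BoolFn n} {d : Bool} → AbsorbingValue f d → FullySensitive f (replicate n (not d))
absorbing⇒sensitive {n} {f} {d} absorbing i =
  values⇒sensitive {f = f} {r} {i} d (absorbs (r [ i ]≔ d) i (lookup∘update i r d)) (trans (cong f r[i]≔not-d≡r) otherwise)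
  where
  open AbsorbingValue absorbing
  r = replicate n (not d)
  r[i]≔not-d≡r : r [ i ]≔ not d ≡ r
  r[i]≔not-d≡r = trans (cong (r [ i ]≔_) (sym (lookup-replicate i (not d)))) ([]≔-lookup r i)

absorbing⇒Γ≡n : {f : BoolFn n} {d : Bool} → AbsorbingValue f d → GammaIs f n
absorbing⇒Γ≡n {n} {f} {d} absorbing =
  TriggeredGoal.Γ≡n {f = f} (hasLit d) (isLit d ∘ lit) (λ {b} {b′} → hasLit-⪰ d {b} {b′}) (hasLit-set d) certificate completion
    (hasLit-replicate⋆ d n)
  where
  open AbsorbingValue absorbing
  certificate : ∀ b → hasLit d b ≡ true → IsCert f b
  certificate b has with hasLit⇒lookup d b has
  ... | i , bᵢ≡d = d , λ a a⪰b → absorbs a i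
          (lit-injective (trans (sym (lookup-map i lit a)) (trans (a⪰b i (lit≢⋆ d ∘ trans (sym bᵢ≡d))) bᵢ≡d)))
  completion : ∀ b → hasLit d b ≡ false → ∃ λ a → total a ⪰ b × FullySensitive f a
  completion b ¬has = replicate n (not d) , ¬hasLit⇒⪰ d b ¬has , absorbing⇒sensitive absorbing

AND-absorbing : AbsorbingValue (AND {n}) false
AND-absorbing {n} = record { absorbs = absorbs ; otherwise = all-true n }
  where
  absorbs : ∀ {n} (a : Vec Bool n) i → lookup a i ≡ false → AND a ≡ false
  absorbs (x ∷ a) zero    refl = refl
  absorbs (x ∷ a) (suc i) aᵢ≡false rewrite absorbs a i aᵢ≡false = ∧-zeroʳ x
  all-true : ∀ n → AND (replicate n true) ≡ true
  all-true zero    = refl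
  all-true (suc n) = all-true n

OR-absorbing : AbsorbingValue (OR {n}) true
OR-absorbing {n} = record { absorbs = absorbs ; otherwise = all-false n }
  where
  absorbs : ∀ {n} (a : Vec Bool n) i → lookup a i ≡ true → OR a ≡ true
  absorbs (x ∷ a) zero    refl = refl
  absorbs (x ∷ a) (suc i) aᵢ≡true rewrite absorbs a i aᵢ≡true = ∨-zeroʳ x
  all-false : ∀ n → OR (replicate n false) ≡ false
  all-false zero    = refl
  all-false (suc n) = all-false n

XOR-flip : (a : Vec Bool n) (i : Fin n) → XOR (a [ i ]≔ true) ≡ not (XOR (a [ i ]≔ false))
XOR-flip (x ∷ a) zero    = refl
XOR-flip (x ∷ a) (suc i) rewrite XOR-flip a i with x
... | true  = refl
... | false = refl

XOR-sensitive : (a : Vec Bool n) → FullySensitive XOR a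
XOR-sensitive a i eq = not-¬ eq (XOR-flip a i)

fill : Tri → Bool
fill b1 = true
fill _  = false

lit-fill : ∀ t → t ≢ ⋆ → lit (fill t) ≡ t
lit-fill ⋆  t≢⋆ = ⊥-elim (t≢⋆ refl)
lit-fill b0 _   = refl
lit-fill b1 _   = refl

map-fill-⪰ : (b : PA n) → total (map fill b) ⪰ b
map-fill-⪰ b j bⱼ≢⋆ = trans (lookup-map j lit (map fill b)) (trans (cong lit (lookup-map j fill b)) (lit-fill _ bⱼ≢⋆))

XOR-Γ≡n : GammaIs (XOR {n}) n
XOR-Γ≡n {n} = TriggeredGoal.Γ≡n {f = XOR} (λ _ → false) (λ _ → false) (λ _ ()) (λ _ _ _ _ → refl) (λ _ ())
  (λ b _ → map fill b , map-fill-⪰ b , XOR-sensitive (map fill b)) refl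

ContainsCert-not : {f : BoolFn n} {b : PA n} → ContainsCert f b ⇔ ContainsCert (not ∘ f) b
ContainsCert-not {f = f} = mk⇔
  (λ (c , b⪰c , v , isCert) → c , b⪰c , not v , λ a a⪰c → cong not (isCert a a⪰c))
  (λ (c , b⪰c , v , isCert) → c , b⪰c , not v , λ a a⪰c → trans (sym (not-involutive (f a))) (cong not (isCert a a⪰c)))

IsGoalFunction-⇔ : {f f′ : BoolFn n} {g : PA n → ℕ} {Q : ℕ} → (∀ b → ContainsCert f b ⇔ ContainsCert f′ b) →
  IsGoalFunction f g Q → IsGoalFunction f′ g Q
IsGoalFunction-⇔ cert⇔ (monotone , submodular , goal-at-total , goal⇔cert) =
  monotone , submodular , goal-at-total , λ b → cert⇔ b ⇔-∘ goal⇔cert b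

Γ-not : {f : BoolFn n} {m : ℕ} → GammaIs f m → GammaIs (not ∘ f) m
Γ-not ((g , isGoal) , minimal) =
  (g , IsGoalFunction-⇔ (λ b → ContainsCert-not {b = b}) isGoal) ,
  λ g′ Q isGoal′ → minimal g′ Q (IsGoalFunction-⇔ (λ b → ⇔-sym (ContainsCert-not {b = b})) isGoal′)

proposition3 : (n : ℕ) → 1 ≤ n →
    GammaIs (AND {n}) n × GammaIs (OR {n}) n × GammaIs (XOR {n}) n ×
    GammaIs (NAND {n}) n × GammaIs (NOR {n}) n × GammaIs (XNOR {n}) n
proposition3 n _ = AND-Γ≡n , OR-Γ≡n , XOR-Γ≡n , Γ-not AND-Γ≡n , Γ-not OR-Γ≡n , Γ-not XOR-Γ≡n
  where
  AND-Γ≡n : GammaIs (AND {n}) n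
  AND-Γ≡n = absorbing⇒Γ≡n AND-absorbing
  OR-Γ≡n : GammaIs (OR {n}) n
  OR-Γ≡n = absorbing⇒Γ≡n OR-absorbing
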